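{- Let $n\geq 4$, let $C=\operatorname{circ}(1,0,\ldots,0,1)$ be the circulant matrix of order $n-1$, let $X=2(CC^T+I_{n-1})^{ -1}\left[ (n-1)I_{n-1}-J_{n-1}\right]$ and $Y=J_{n-1}+C^TX$. Then $Y=\operatorname{circ}(d_0,d_1,\ldots,d_{n-2})$, where \[d_0=\frac{1}{5}+\frac{4(n-1)}{\sqrt{5}}\left[\frac{2^{n-2}+(-3+\sqrt{5})^{n-2}}{2^{n-1}-(-3+\sqrt{5})^{n-1}} -\frac{2^{n-2}+(-3-\sqrt{5})^{n-2}}{2^{n-1}-(-3-\sqrt{5})^{n-1}}\right]\] and for $j=1,2,\ldots,n-2$, \[d_j=\frac{1}{5}+\frac{2^{n+1-j}(n-1)}{5+\sqrt{5}}\left[\frac{2(-3+\sqrt{5})^{j-1}}{2^{n-1}-(-3+\sqrt{5})^{n-1}} -\frac{(-3-\sqrt{5})^{j}}{2^{n-1}-(-3-\sqrt{5})^{n-1}}\right].\]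
   Context: For real numbers $c_0,\ldots,c_{k-1}$, $\operatorname{circ}(c_0,c_1,\ldots,c_{k-1})$ denotes the $k\times k$ circulant matrix whose $(i,j)$-entry is $c_{(j-i)\bmod k}$. $I_k$ is the $k\times k$ identity matrix and $J_k$ the $k\times k$ all-ones matrix. -}

module Defs where

open import Data.Nat as ℕ using (ℕ; zero; suc; _≤ᵇ_)
open import Data.Bool using (Bool; true; false; if_then_else_; _∨_)
open import Data.Fin using (Fin; toℕ) renaming (zero to fzero; suc to fsuc)
open import Data.Integer using (+_)
open import Data.Rational as ℚ using (ℚ; 0ℚ; 1ℚ; 1/_; ≢-nonZero)
open import Data.Rational.Properties using (_≟_)
open import Relation.Nullary using (yes; no)
open import Relation.Binary.PropositionalEquality using (_≡_)

-- Real matrices of order m, modelled over ℚ (all data here is rational)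

Mat : ℕ → Set
Mat m = Fin m → Fin m → ℚ

sumFin : ∀ {m} → (Fin m → ℚ) → ℚ
sumFin {zero}  f = 0ℚ
sumFin {suc m} f = f fzero ℚ.+ sumFin (λ i → f (fsuc i))

infixl 7 _⊗_
infixl 6 _⊕_ _⊖_
infix 4 _≐_
_⊗_ : ∀ {m} → Mat m → Mat m → Mat m
(A ⊗ B) i j = sumFin (λ k → A i k ℚ.* B k j)

_⊕_ : ∀ {m} → Mat m → Mat m → Mat m
(A ⊕ B) i j = A i j ℚ.+ B i j

_⊖_ : ∀ {m} → Mat m → Mat m → Mat m
(A ⊖ B) i j = A i j ℚ.- B i j

scale : ∀ {m} → ℚ → Mat m → Mat m
scale c A i j = c ℚ.* A i j

_≐_ : ∀ {m} → Mat m → Mat m → Set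
_≐_ {m} A B = (i j : Fin m) → A i j ≡ B i j

transpose : ∀ {m} → Mat m → Mat m
transpose A i j = A j i

natℚ : ℕ → ℚ
natℚ k = + k ℚ./ 1

I : ∀ m → Mat m
I m i j = if toℕ i ℕ.≡ᵇ toℕ j then 1ℚ else 0ℚ

J : ∀ m → Mat m
J m i j = 1ℚ

circIdx : ∀ m → Fin m → Fin m → ℕ
circIdx m i j = if toℕ i ≤ᵇ toℕ j then toℕ j ℕ.∸ toℕ i
                else (m ℕ.+ toℕ j) ℕ.∸ toℕ i

circ : ∀ {A : Set} m → (ℕ → A) → Fin m → Fin m → A
circ m c i j = c (circIdx m i j)

Cmat : ∀ m → Mat m
Cmat m = circ m (λ k → if (k ℕ.≡ᵇ 0) ∨ (k ℕ.≡ᵇ (m ℕ.∸ 1)) then 1ℚ else 0ℚ)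

-- The field ℚ(√5) ⊂ ℝ : re + im·√5

infix 4 _+√5·_
record Q5 : Set where
  constructor _+√5·_
  field
    re im : ℚ
open Q5 public

invℚ : ℚ → ℚ
invℚ p with p ≟ 0ℚ
... | yes _ = 0ℚ
... | no p≢0 = 1/_ p {{≢-nonZero p≢0}}

infixl 6 _⊞_ _⊟_
infixl 7 _⊠_ _⊘_

_⊞_ : Q5 → Q5 → Q5
(a +√5· b) ⊞ (c +√5· d) = (a ℚ.+ c) +√5· (b ℚ.+ d)

neg : Q5 → Q5
neg (a +√5· b) = ℚ.- a +√5· ℚ.- b

_⊟_ : Q5 → Q5 → Q5
x ⊟ y = x ⊞ neg y

_⊠_ : Q5 → Q5 → Q5
(a +√5· b) ⊠ (c +√5· d) =
  (a ℚ.* c ℚ.+ natℚ 5 ℚ.* (b ℚ.* d)) +√5· (a ℚ.* d ℚ.+ b ℚ.* c)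

-- inverse (a - b√5)/(a² - 5b²); a nonzero element has nonzero norm.
-- (total: the inverse of 0 is 0, never used on 0 in the statement)
inv : Q5 → Q5
inv (a +√5· b) = (a ℚ.* N⁻¹) +√5· (ℚ.- b ℚ.* N⁻¹)
  where N⁻¹ = invℚ (a ℚ.* a ℚ.- natℚ 5 ℚ.* (b ℚ.* b))

_⊘_ : Q5 → Q5 → Q5
x ⊘ y = x ⊠ inv y

embed : ℚ → Q5
embed q = q +√5· 0ℚ

nat : ℕ → Q5
nat k = embed (natℚ k)

√5 : Q5
√5 = 0ℚ +√5· 1ℚ

_^_ : Q5 → ℕ → Q5
x ^ zero = nat 1
x ^ suc k = x ⊠ (x ^ k)

α β : Q5
α = neg (nat 3) ⊞ √5
β = neg (nat 3) ⊟ √5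

d : ℕ → ℕ → Q5
d n zero =
  (nat 1 ⊘ nat 5) ⊞
  ((nat 4 ⊠ nat (n ℕ.∸ 1)) ⊘ √5) ⊠
    ( ((nat 2 ^ (n ℕ.∸ 2)) ⊞ (α ^ (n ℕ.∸ 2))) ⊘ ((nat 2 ^ (n ℕ.∸ 1)) ⊟ (α ^ (n ℕ.∸ 1)))
    ⊟ ((nat 2 ^ (n ℕ.∸ 2)) ⊞ (β ^ (n ℕ.∸ 2))) ⊘ ((nat 2 ^ (n ℕ.∸ 1)) ⊟ (β ^ (n ℕ.∸ 1))))
d n (suc i) =   -- j = suc i, so j - 1 = i
  (nat 1 ⊘ nat 5) ⊞
  (((nat 2 ^ ((n ℕ.+ 1) ℕ.∸ suc i)) ⊠ nat (n ℕ.∸ 1)) ⊘ (nat 5 ⊞ √5)) ⊠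
    ( (nat 2 ⊠ (α ^ i)) ⊘ ((nat 2 ^ (n ℕ.∸ 1)) ⊟ (α ^ (n ℕ.∸ 1)))
    ⊟ (β ^ suc i) ⊘ ((nat 2 ^ (n ℕ.∸ 1)) ⊟ (β ^ (n ℕ.∸ 1))))

-- Write m = n − 1 and C = I + P with P the cyclic shift. Column by column, (CCᵀ + I) X = B is the
-- cyclic three-term system x(i−1) + 3 x(i) + x(i+1) = bᵢ. It has at most one solution by a maximum
-- principle: at an entry of largest modulus, 3|x| ≤ 2|x|. A solution is written down over ℚ(√5)
-- from the roots r, s = (−3 ± √5)/2 of t² + 3t + 1, as G(k) = (rᵏρ − sᵏσ)/√5 with ρ = 1/(1 − rᵐ) and
-- σ = 1/(1 − sᵐ), which satisfies the recurrence together with G(m) = G(0) and G(1) − G(m+1) = 1;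
-- then X(i, j) = z((j − i) mod m) with z(k) = 2m G(k) − 2/5. This candidate is rational because its
-- irrational part solves the homogeneous system. Finally Y = J + CᵀX has entries 1 + z(k) + z(k−1),
-- which rearrange to the stated dₖ since α = 2r and β = 2s. Here 1 − rᵐ is invertible because
-- (1 − rᵐ)(1 − sᵐ) = 2 ∓ Lₘ with Lₘ ≥ 3 a Lucas number.
module Submission where

open import Defs
open import Algebra.Bundles using (CommutativeRing)
open import Data.Bool using (true; false; if_then_else_; T; _∨_)
open import Data.Empty using (⊥-elim)
open import Data.Fin as Fin using (Fin; toℕ) renaming (zero to fzero; suc to fsuc)
import Data.Fin.Properties as Fin
open import Data.Integer as ℤ using (+_)
import Data.Integer.Properties as ℤ
open import Data.Maybe using (just; nothing)
open import Data.Nat as ℕ using (ℕ; zero; suc; _+_; _*_; _∸_; _%_; _<_; _≤_; _≤ᵇ_; _≡ᵇ_; NonZero; s≤s)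
import Data.Nat.Coprimality as Coprime
open import Data.Nat.DivMod
  using (_/_; _mod_; %-distribˡ-+; m%n%n≡m%n; m≡m%n+[m/n]*n; m%n≤n; m%n<n; m<n⇒m%n≡m;
         [m+n]%n≡m%n; [m+kn]%n≡m%n; n%n≡0)
import Data.Nat.Properties as ℕ
open import Data.Nat.Tactic.RingSolver using () renaming (ring to ℕ-ring)
open import Data.Product using (Σ; _×_; ∃-syntax; _,_; proj₁; proj₂)
open import Data.Rational as ℚ using (ℚ; 0ℚ; 1ℚ; mkℚ)
import Data.Rational.Properties as ℚ
open import Algebra.Properties.Semiring.Sum (CommutativeRing.semiring ℚ.+-*-commutativeRing)
  using (sum-cong-≗; ∑-distrib-+; ∑-comm; *-distribˡ-sum; *-distribʳ-sum; sum-syntax)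
open import Data.Sum using (_⊎_; inj₁; inj₂; [_,_]′)
open import Data.Unit using (tt)
open import Function using (_∘_; id)
open import Relation.Binary.PropositionalEquality
  using (_≡_; refl; sym; trans; cong; cong₂; subst; subst₂; isEquivalence; module ≡-Reasoning)
open import Algebra.Structures {A = Q5} _≡_ using (IsCommutativeRing)
open import Relation.Nullary using (¬_; yes; no)
open import Relation.Nullary.Decidable using (dec⇒maybe)
open import Relation.Nullary.Reflects using (ofʸ; ofⁿ)
open import Tactic.RingSolver using (solve-∀)
import Tactic.RingSolver.Core.AlmostCommutativeRing as ACR
open ≡-Reasoning

ℚ-ring : ACR.AlmostCommutativeRing _ _
ℚ-ring = ACR.fromCommutativeRing ℚ.+-*-commutativeRing (λ x → dec⇒maybe (0ℚ ℚ.≟ x))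

-- ℚ(√5)

infix 4 _+√5·≡_
_+√5·≡_ : ∀ {a b c e : ℚ} → a ≡ c → b ≡ e → (a +√5· b) ≡ (c +√5· e)
_+√5·≡_ = cong₂ _+√5·_

𝟘 𝟙 : Q5
𝟘 = embed 0ℚ
𝟙 = embed 1ℚ

⊞-assoc : ∀ x y z → (x ⊞ y) ⊞ z ≡ x ⊞ (y ⊞ z)
⊞-assoc x y z = ℚ.+-assoc (re x) (re y) (re z) +√5·≡ ℚ.+-assoc (im x) (im y) (im z)

⊠-comm : ∀ x y → x ⊠ y ≡ y ⊠ x
⊠-comm (a +√5· b) (c +√5· e) = re-comm a b c e +√5·≡ im-comm a b c e
  where
  re-comm : ∀ a b c e → a ℚ.* c ℚ.+ natℚ 5 ℚ.* (b ℚ.* e) ≡ c ℚ.* a ℚ.+ natℚ 5 ℚ.* (e ℚ.* b)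
  re-comm = solve-∀ ℚ-ring
  im-comm : ∀ a b c e → a ℚ.* e ℚ.+ b ℚ.* c ≡ c ℚ.* b ℚ.+ e ℚ.* a
  im-comm = solve-∀ ℚ-ring

⊠-assoc : ∀ x y z → (x ⊠ y) ⊠ z ≡ x ⊠ (y ⊠ z)
⊠-assoc (a +√5· b) (c +√5· e) (f +√5· g) = re-assoc a b c e f g +√5·≡ im-assoc a b c e f g
  where
  re-assoc : ∀ a b c e f g →
    (a ℚ.* c ℚ.+ natℚ 5 ℚ.* (b ℚ.* e)) ℚ.* f ℚ.+ natℚ 5 ℚ.* ((a ℚ.* e ℚ.+ b ℚ.* c) ℚ.* g)
      ≡ a ℚ.* (c ℚ.* f ℚ.+ natℚ 5 ℚ.* (e ℚ.* g)) ℚ.+ natℚ 5 ℚ.* (b ℚ.* (c ℚ.* g ℚ.+ e ℚ.* f))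
  re-assoc = solve-∀ ℚ-ring
  im-assoc : ∀ a b c e f g →
    (a ℚ.* c ℚ.+ natℚ 5 ℚ.* (b ℚ.* e)) ℚ.* g ℚ.+ (a ℚ.* e ℚ.+ b ℚ.* c) ℚ.* f
      ≡ a ℚ.* (c ℚ.* g ℚ.+ e ℚ.* f) ℚ.+ b ℚ.* (c ℚ.* f ℚ.+ natℚ 5 ℚ.* (e ℚ.* g))
  im-assoc = solve-∀ ℚ-ring

⊠-identityˡ : ∀ x → 𝟙 ⊠ x ≡ x
⊠-identityˡ (a +√5· b) = re-identity a b +√5·≡ im-identity a b
  where
  re-identity : ∀ a b → 1ℚ ℚ.* a ℚ.+ natℚ 5 ℚ.* (0ℚ ℚ.* b) ≡ a
  re-identity = solve-∀ ℚ-ring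
  im-identity : ∀ a b → 1ℚ ℚ.* b ℚ.+ 0ℚ ℚ.* a ≡ b
  im-identity = solve-∀ ℚ-ring

⊠-identityʳ : ∀ x → x ⊠ 𝟙 ≡ x
⊠-identityʳ x = trans (⊠-comm x 𝟙) (⊠-identityˡ x)

⊠-distribˡ-⊞ : ∀ x y z → x ⊠ (y ⊞ z) ≡ x ⊠ y ⊞ x ⊠ z
⊠-distribˡ-⊞ (a +√5· b) (c +√5· e) (f +√5· g) = re-distrib a b c e f g +√5·≡ im-distrib a b c e f g
  where
  re-distrib : ∀ a b c e f g → a ℚ.* (c ℚ.+ f) ℚ.+ natℚ 5 ℚ.* (b ℚ.* (e ℚ.+ g))
    ≡ (a ℚ.* c ℚ.+ natℚ 5 ℚ.* (b ℚ.* e)) ℚ.+ (a ℚ.* f ℚ.+ natℚ 5 ℚ.* (b ℚ.* g))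
  re-distrib = solve-∀ ℚ-ring
  im-distrib : ∀ a b c e f g → a ℚ.* (e ℚ.+ g) ℚ.+ b ℚ.* (c ℚ.+ f)
    ≡ (a ℚ.* e ℚ.+ b ℚ.* c) ℚ.+ (a ℚ.* g ℚ.+ b ℚ.* f)
  im-distrib = solve-∀ ℚ-ring

Q5-isCommutativeRing : IsCommutativeRing _⊞_ _⊠_ neg 𝟘 𝟙
Q5-isCommutativeRing = record
  { isRing = record
    { +-isAbelianGroup = record
      { isGroup = record
        { isMonoid = record
          { isSemigroup = record
            { isMagma = record { isEquivalence = isEquivalence ; ∙-cong = cong₂ _⊞_ }
            ; assoc = ⊞-assoc }
          ; identity = (λ x → ℚ.+-identityˡ (re x) +√5·≡ ℚ.+-identityˡ (im x))
                     , (λ x → ℚ.+-identityʳ (re x) +√5·≡ ℚ.+-identityʳ (im x)) }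
        ; inverse = (λ x → ℚ.+-inverseˡ (re x) +√5·≡ ℚ.+-inverseˡ (im x))
                  , (λ x → ℚ.+-inverseʳ (re x) +√5·≡ ℚ.+-inverseʳ (im x))
        ; ⁻¹-cong = cong neg }
      ; comm = λ x y → ℚ.+-comm (re x) (re y) +√5·≡ ℚ.+-comm (im x) (im y) }
    ; *-cong = cong₂ _⊠_
    ; *-assoc = ⊠-assoc
    ; *-identity = ⊠-identityˡ , ⊠-identityʳ
    ; distrib = ⊠-distribˡ-⊞
              , λ x y z → trans (⊠-comm (y ⊞ z) x)
                            (trans (⊠-distribˡ-⊞ x y z) (cong₂ _⊞_ (⊠-comm x y) (⊠-comm x z))) }
  ; *-comm = ⊠-comm }

Q5-commutativeRing : CommutativeRing _ _
Q5-commutativeRing = record { isCommutativeRing = Q5-isCommutativeRing }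

Q5-ring : ACR.AlmostCommutativeRing _ _
Q5-ring = ACR.fromCommutativeRing Q5-commutativeRing 𝟘≟_
  where
  𝟘≟_ : ∀ x → _
  𝟘≟ (a +√5· b) with 0ℚ ℚ.≟ a | 0ℚ ℚ.≟ b
  ... | yes a≡0 | yes b≡0 = just (a≡0 +√5·≡ b≡0)
  ... | _       | _       = nothing

open import Algebra.Properties.CommutativeSemigroup
  (CommutativeRing.*-commutativeSemigroup Q5-commutativeRing) using (interchange)
open import Algebra.Properties.Group (CommutativeRing.+-group Q5-commutativeRing) using (x∙y⁻¹≈ε⇒x≈y)

^-homo-⊠ : ∀ x a b → x ^ (a + b) ≡ x ^ a ⊠ x ^ b
^-homo-⊠ x zero    b = sym (⊠-identityˡ (x ^ b))
^-homo-⊠ x (suc a) b = trans (cong (x ⊠_) (^-homo-⊠ x a b)) (sym (⊠-assoc x (x ^ a) (x ^ b)))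

^-distrib-⊠ : ∀ x y k → (x ⊠ y) ^ k ≡ x ^ k ⊠ y ^ k
^-distrib-⊠ x y zero    = refl
^-distrib-⊠ x y (suc k) = trans (cong ((x ⊠ y) ⊠_) (^-distrib-⊠ x y k)) (interchange x y (x ^ k) (y ^ k))

𝟙^ : ∀ k → 𝟙 ^ k ≡ 𝟙
𝟙^ zero    = refl
𝟙^ (suc k) = trans (⊠-identityˡ (𝟙 ^ k)) (𝟙^ k)

embed-⊠ : ∀ a b → embed a ⊠ embed b ≡ embed (a ℚ.* b)
embed-⊠ a b = ℚ.+-identityʳ (a ℚ.* b) +√5·≡ cong₂ ℚ._+_ (ℚ.*-zeroʳ a) (ℚ.*-zeroˡ b)

embed-re : ∀ x → im x ≡ 0ℚ → embed (re x) ≡ x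
embed-re x im≡0 = refl +√5·≡ sym im≡0

re-3term : ∀ a b c → re (a ⊞ nat 3 ⊠ b ⊞ c) ≡ re a ℚ.+ natℚ 3 ℚ.* re b ℚ.+ re c
re-3term a b c = identity (re a) (re b) (im b) (re c)
  where
  identity : ∀ a b b′ c →
    a ℚ.+ (natℚ 3 ℚ.* b ℚ.+ natℚ 5 ℚ.* (0ℚ ℚ.* b′)) ℚ.+ c ≡ a ℚ.+ natℚ 3 ℚ.* b ℚ.+ c
  identity = solve-∀ ℚ-ring

im-3term : ∀ a b c → im (a ⊞ nat 3 ⊠ b ⊞ c) ≡ im a ℚ.+ natℚ 3 ℚ.* im b ℚ.+ im c
im-3term a b c = identity (im a) (im b) (re b) (im c)
  where
  identity : ∀ a b b′ c → a ℚ.+ (natℚ 3 ℚ.* b ℚ.+ 0ℚ ℚ.* b′) ℚ.+ c ≡ a ℚ.+ natℚ 3 ℚ.* b ℚ.+ c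
  identity = solve-∀ ℚ-ring

norm : Q5 → ℚ
norm (a +√5· b) = a ℚ.* a ℚ.- natℚ 5 ℚ.* (b ℚ.* b)

norm-homo-⊠ : ∀ x y → norm (x ⊠ y) ≡ norm x ℚ.* norm y
norm-homo-⊠ (a +√5· b) (c +√5· e) = identity a b c e
  where
  identity : ∀ a b c e →
    (a ℚ.* c ℚ.+ natℚ 5 ℚ.* (b ℚ.* e)) ℚ.* (a ℚ.* c ℚ.+ natℚ 5 ℚ.* (b ℚ.* e))
      ℚ.- natℚ 5 ℚ.* ((a ℚ.* e ℚ.+ b ℚ.* c) ℚ.* (a ℚ.* e ℚ.+ b ℚ.* c))
    ≡ (a ℚ.* a ℚ.- natℚ 5 ℚ.* (b ℚ.* b)) ℚ.* (c ℚ.* c ℚ.- natℚ 5 ℚ.* (e ℚ.* e))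
  identity = solve-∀ ℚ-ring

invℚ-inverseʳ : ∀ q → ¬ q ≡ 0ℚ → q ℚ.* invℚ q ≡ 1ℚ
invℚ-inverseʳ q q≢0 with q ℚ.≟ 0ℚ
... | yes q≡0 = ⊥-elim (q≢0 q≡0)
... | no  q≢0 = ℚ.*-inverseʳ q {{ℚ.≢-nonZero q≢0}}

inv-inverseˡ : ∀ x → ¬ norm x ≡ 0ℚ → inv x ⊠ x ≡ 𝟙
inv-inverseˡ x@(a +√5· b) N≢0 =
  trans (re-inv a b (invℚ (norm x))) (invℚ-inverseʳ (norm x) N≢0) +√5·≡ im-inv a b (invℚ (norm x))
  where
  re-inv : ∀ a b i → a ℚ.* i ℚ.* a ℚ.+ natℚ 5 ℚ.* (ℚ.- b ℚ.* i ℚ.* b)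
                     ≡ (a ℚ.* a ℚ.- natℚ 5 ℚ.* (b ℚ.* b)) ℚ.* i
  re-inv = solve-∀ ℚ-ring
  im-inv : ∀ a b i → a ℚ.* i ℚ.* b ℚ.+ ℚ.- b ℚ.* i ℚ.* a ≡ 0ℚ
  im-inv = solve-∀ ℚ-ring

inv-unique : ∀ x y → x ⊠ y ≡ 𝟙 → inv x ≡ y
inv-unique x y xy≡𝟙 = begin
  inv x             ≡⟨ ⊠-identityʳ (inv x) ⟨
  inv x ⊠ 𝟙         ≡⟨ cong (inv x ⊠_) xy≡𝟙 ⟨
  inv x ⊠ (x ⊠ y)   ≡⟨ ⊠-assoc (inv x) x y ⟨
  (inv x ⊠ x) ⊠ y   ≡⟨ cong (_⊠ y) (inv-inverseˡ x N≢0) ⟩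
  𝟙 ⊠ y             ≡⟨ ⊠-identityˡ y ⟩
  y                 ∎
  where
  N≢0 : ¬ norm x ≡ 0ℚ
  N≢0 N≡0 = ℚ.1≢0 (begin
    1ℚ                 ≡⟨ cong norm xy≡𝟙 ⟨
    norm (x ⊠ y)       ≡⟨ norm-homo-⊠ x y ⟩
    norm x ℚ.* norm y  ≡⟨ cong (ℚ._* norm y) N≡0 ⟩
    0ℚ ℚ.* norm y      ≡⟨ ℚ.*-zeroˡ (norm y) ⟩
    0ℚ                 ∎)

⊠-inverse-from-norm : ∀ x y {q} → x ⊠ y ≡ embed q → ¬ q ≡ 0ℚ → x ⊠ (y ⊠ embed (invℚ q)) ≡ 𝟙
⊠-inverse-from-norm x y {q} xy≡q q≢0 = begin
  x ⊠ (y ⊠ embed (invℚ q))   ≡⟨ ⊠-assoc x y (embed (invℚ q)) ⟨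
  (x ⊠ y) ⊠ embed (invℚ q)   ≡⟨ cong (_⊠ embed (invℚ q)) xy≡q ⟩
  embed q ⊠ embed (invℚ q)   ≡⟨ embed-⊠ q (invℚ q) ⟩
  embed (q ℚ.* invℚ q)       ≡⟨ cong embed (invℚ-inverseʳ q q≢0) ⟩
  𝟙                          ∎

coprime-1 : ∀ k → Coprime.Coprime k 1
coprime-1 k = Coprime.sym (Coprime.1-coprimeTo k)

natℚ≡mkℚ : ∀ k → natℚ k ≡ mkℚ (+ k) 0 (coprime-1 k)
natℚ≡mkℚ k = ℚ.normalize-coprime (coprime-1 k)

natℚ-injective : ∀ {a b} → natℚ a ≡ natℚ b → a ≡ b
natℚ-injective {a} {b} eq = ℤ.+-injective (cong ℚ.↥_ (trans (sym (natℚ≡mkℚ a)) (trans eq (natℚ≡mkℚ b))))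

natℚ-homo-+ : ∀ a b → natℚ (a + b) ≡ natℚ a ℚ.+ natℚ b
natℚ-homo-+ a b = begin
  natℚ (a + b)
    ≡⟨ cong (ℚ._/ 1) numerator ⟨
  (+ a ℤ.* + 1 ℤ.+ + b ℤ.* + 1) ℚ./ 1
    ≡⟨⟩
  mkℚ (+ a) 0 (coprime-1 a) ℚ.+ mkℚ (+ b) 0 (coprime-1 b)
    ≡⟨ cong₂ ℚ._+_ (natℚ≡mkℚ a) (natℚ≡mkℚ b) ⟨
  natℚ a ℚ.+ natℚ b
    ∎
  where
  numerator : + a ℤ.* + 1 ℤ.+ + b ℤ.* + 1 ≡ + (a + b)
  numerator = trans (cong₂ ℤ._+_ (ℤ.*-identityʳ (+ a)) (ℤ.*-identityʳ (+ b))) (sym (ℤ.pos-+ a b))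

-- The roots r, s = (−3 ± √5)/2 of t² + 3t + 1

^-rec : ∀ x → x ⊠ x ≡ neg (nat 3 ⊠ x) ⊟ 𝟙 →
        ∀ k → x ^ suc (suc k) ≡ neg (nat 3 ⊠ x ^ suc k) ⊟ x ^ k
^-rec x x²≡ k = begin
  x ⊠ (x ⊠ x ^ k)                    ≡⟨ ⊠-assoc x x (x ^ k) ⟨
  (x ⊠ x) ⊠ x ^ k                    ≡⟨ cong (_⊠ x ^ k) x²≡ ⟩
  (neg (nat 3 ⊠ x) ⊟ 𝟙) ⊠ x ^ k      ≡⟨ identity x (x ^ k) ⟩
  neg (nat 3 ⊠ (x ⊠ x ^ k)) ⊟ x ^ k  ∎
  where
  identity : ∀ x y → (neg (nat 3 ⊠ x) ⊟ 𝟙) ⊠ y ≡ neg (nat 3 ⊠ (x ⊠ y)) ⊟ y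
  identity = solve-∀ Q5-ring

half : Q5
half = embed (+ 1 ℚ./ 2)

r s : Q5
r = half ⊠ α
s = half ⊠ β

r-root : r ⊠ r ≡ neg (nat 3 ⊠ r) ⊟ 𝟙
r-root = refl

s-root : s ⊠ s ≡ neg (nat 3 ⊠ s) ⊟ 𝟙
s-root = refl

α^ : ∀ k → α ^ k ≡ nat 2 ^ k ⊠ r ^ k
α^ = ^-distrib-⊠ (nat 2) r

β^ : ∀ k → β ^ k ≡ nat 2 ^ k ⊠ s ^ k
β^ = ^-distrib-⊠ (nat 2) s

2^⊠half^ : ∀ k → nat 2 ^ k ⊠ half ^ k ≡ 𝟙
2^⊠half^ k = trans (sym (^-distrib-⊠ (nat 2) half k)) (𝟙^ k)

-- lucas k = |rᵏ + sᵏ| = 2, 3, 7, 18, …, generated together with gap k = lucas (k + 1) − lucas k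
-- so that no truncated subtraction occurs.
lucas gap : ℕ → ℕ
lucas zero    = 2
lucas (suc k) = lucas k + gap k
gap zero      = 1
gap (suc k)   = gap k + lucas (suc k)

−1^ : ℕ → ℚ
−1^ zero    = 1ℚ
−1^ (suc k) = ℚ.- −1^ k

lucas-sum : ∀ k → r ^ k ⊞ s ^ k ≡ embed (−1^ k ℚ.* natℚ (lucas k))
lucas-sum zero          = refl
lucas-sum (suc zero)    = refl
lucas-sum (suc (suc k)) = begin
  r ^ suc (suc k) ⊞ s ^ suc (suc k)
    ≡⟨ cong₂ _⊞_ (^-rec r r-root k) (^-rec s s-root k) ⟩
  (neg (nat 3 ⊠ r ^ suc k) ⊟ r ^ k) ⊞ (neg (nat 3 ⊠ s ^ suc k) ⊟ s ^ k)
    ≡⟨ regroup (r ^ suc k) (r ^ k) (s ^ suc k) (s ^ k) ⟩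
  neg (nat 3 ⊠ (r ^ suc k ⊞ s ^ suc k)) ⊟ (r ^ k ⊞ s ^ k)
    ≡⟨ cong₂ (λ a b → neg (nat 3 ⊠ a) ⊟ b) (lucas-sum (suc k)) (lucas-sum k) ⟩
  neg (nat 3 ⊠ embed (−1^ (suc k) ℚ.* L₁)) ⊟ embed (−1^ k ℚ.* L₀)
    ≡⟨ cong (λ a → neg a ⊟ embed (−1^ k ℚ.* L₀)) (embed-⊠ (natℚ 3) (−1^ (suc k) ℚ.* L₁)) ⟩
  embed (ℚ.- (natℚ 3 ℚ.* (ℚ.- −1^ k ℚ.* L₁)) ℚ.- −1^ k ℚ.* L₀)
    ≡⟨ cong (λ a → embed (ℚ.- (natℚ 3 ℚ.* (ℚ.- −1^ k ℚ.* a)) ℚ.- −1^ k ℚ.* L₀)) L₁≡ ⟩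
  embed (ℚ.- (natℚ 3 ℚ.* (ℚ.- −1^ k ℚ.* (L₀ ℚ.+ g₀))) ℚ.- −1^ k ℚ.* L₀)
    ≡⟨ cong embed (recurrence (−1^ k) L₀ g₀) ⟩
  embed (−1^ (suc (suc k)) ℚ.* ((L₀ ℚ.+ g₀) ℚ.+ (g₀ ℚ.+ (L₀ ℚ.+ g₀))))
    ≡⟨ cong (λ a → embed (−1^ (suc (suc k)) ℚ.* a)) L₂≡ ⟨
  embed (−1^ (suc (suc k)) ℚ.* natℚ (lucas (suc (suc k))))
    ∎
  where
  L₀ = natℚ (lucas k)
  L₁ = natℚ (lucas (suc k))
  g₀ = natℚ (gap k)
  L₁≡ : L₁ ≡ L₀ ℚ.+ g₀
  L₁≡ = natℚ-homo-+ (lucas k) (gap k)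
  L₂≡ : natℚ (lucas (suc (suc k))) ≡ (L₀ ℚ.+ g₀) ℚ.+ (g₀ ℚ.+ (L₀ ℚ.+ g₀))
  L₂≡ = trans (natℚ-homo-+ (lucas (suc k)) (gap (suc k)))
          (cong₂ ℚ._+_ L₁≡ (trans (natℚ-homo-+ (gap k) (lucas (suc k))) (cong (g₀ ℚ.+_) L₁≡)))
  regroup : ∀ a₁ a₀ b₁ b₀ →
    (neg (nat 3 ⊠ a₁) ⊟ a₀) ⊞ (neg (nat 3 ⊠ b₁) ⊟ b₀)
      ≡ neg (nat 3 ⊠ (a₁ ⊞ b₁)) ⊟ (a₀ ⊞ b₀)
  regroup = solve-∀ Q5-ring
  recurrence : ∀ σ L g → ℚ.- (natℚ 3 ℚ.* (ℚ.- σ ℚ.* (L ℚ.+ g))) ℚ.- σ ℚ.* L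
                         ≡ ℚ.- (ℚ.- σ) ℚ.* ((L ℚ.+ g) ℚ.+ (g ℚ.+ (L ℚ.+ g)))
  recurrence = solve-∀ ℚ-ring

lucas≥2∧gap≥1 : ∀ k → 2 ≤ lucas k × 1 ≤ gap k
lucas≥2∧gap≥1 zero    = ℕ.≤-refl , ℕ.≤-refl
lucas≥2∧gap≥1 (suc k) = ℕ.≤-trans (proj₁ (lucas≥2∧gap≥1 k)) (ℕ.m≤m+n (lucas k) (gap k))
                      , ℕ.≤-trans (proj₂ (lucas≥2∧gap≥1 k)) (ℕ.m≤m+n (gap k) (lucas (suc k)))

lucas-suc≥3 : ∀ k → 3 ≤ lucas (suc k)
lucas-suc≥3 k = ℕ.+-mono-≤ (proj₁ (lucas≥2∧gap≥1 k)) (proj₂ (lucas≥2∧gap≥1 k))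

−1^≡±1 : ∀ k → −1^ k ≡ 1ℚ ⊎ −1^ k ≡ ℚ.- 1ℚ
−1^≡±1 zero    = inj₁ refl
−1^≡±1 (suc k) = [ (λ eq → inj₂ (cong ℚ.-_ eq)) , (λ eq → inj₁ (cong ℚ.-_ eq)) ]′ (−1^≡±1 k)

2-±lucas≢0 : ∀ k → ¬ natℚ 2 ℚ.- −1^ (suc k) ℚ.* natℚ (lucas (suc k)) ≡ 0ℚ
2-±lucas≢0 k q≡0 with −1^≡±1 (suc k)
... | inj₁ σ≡1 = ℕ.>⇒≢ (lucas-suc≥3 k) (natℚ-injective {lucas (suc k)} {2} (begin
  natℚ L
    ≡⟨ identity (natℚ L) ⟩
  natℚ 2 ℚ.- (natℚ 2 ℚ.- 1ℚ ℚ.* natℚ L)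
    ≡⟨ cong (λ σ → natℚ 2 ℚ.- (natℚ 2 ℚ.- σ ℚ.* natℚ L)) σ≡1 ⟨
  natℚ 2 ℚ.- (natℚ 2 ℚ.- −1^ (suc k) ℚ.* natℚ L)
    ≡⟨ cong (λ x → natℚ 2 ℚ.- x) q≡0 ⟩
  natℚ 2
    ∎))
  where
  L = lucas (suc k)
  identity : ∀ L → L ≡ natℚ 2 ℚ.- (natℚ 2 ℚ.- 1ℚ ℚ.* L)
  identity = solve-∀ ℚ-ring
... | inj₂ σ≡-1 = ℕ.1+n≢0 (natℚ-injective {2 + lucas (suc k)} {0} (begin
  natℚ (2 + L)                             ≡⟨ natℚ-homo-+ 2 L ⟩
  natℚ 2 ℚ.+ natℚ L                        ≡⟨ identity (natℚ L) ⟩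
  natℚ 2 ℚ.- ℚ.- 1ℚ ℚ.* natℚ L             ≡⟨ cong (λ σ → natℚ 2 ℚ.- σ ℚ.* natℚ L) σ≡-1 ⟨
  natℚ 2 ℚ.- −1^ (suc k) ℚ.* natℚ L        ≡⟨ q≡0 ⟩
  0ℚ                                       ∎))
  where
  L = lucas (suc k)
  identity : ∀ L → natℚ 2 ℚ.+ L ≡ natℚ 2 ℚ.- ℚ.- 1ℚ ℚ.* L
  identity = solve-∀ ℚ-ring

[𝟙⊟r^k][𝟙⊟s^k] : ∀ k →
  (𝟙 ⊟ r ^ k) ⊠ (𝟙 ⊟ s ^ k) ≡ embed (natℚ 2 ℚ.- −1^ k ℚ.* natℚ (lucas k))
[𝟙⊟r^k][𝟙⊟s^k] k = begin
  (𝟙 ⊟ r ^ k) ⊠ (𝟙 ⊟ s ^ k)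
    ≡⟨ identity (r ^ k) (s ^ k) ⟩
  (𝟙 ⊞ r ^ k ⊠ s ^ k) ⊟ (r ^ k ⊞ s ^ k)
    ≡⟨ cong₂ (λ a b → (𝟙 ⊞ a) ⊟ b) r^k⊠s^k≡𝟙 (lucas-sum k) ⟩
  (𝟙 ⊞ 𝟙) ⊟ embed (−1^ k ℚ.* natℚ (lucas k))
    ∎
  where
  identity : ∀ a b → (𝟙 ⊟ a) ⊠ (𝟙 ⊟ b) ≡ (𝟙 ⊞ a ⊠ b) ⊟ (a ⊞ b)
  identity = solve-∀ Q5-ring
  r^k⊠s^k≡𝟙 : r ^ k ⊠ s ^ k ≡ 𝟙
  r^k⊠s^k≡𝟙 = trans (sym (^-distrib-⊠ r s k)) (𝟙^ k)

inv-2^k⊟[2x]^k : ∀ k x y → (𝟙 ⊟ x ^ k) ⊠ y ≡ 𝟙 → inv (nat 2 ^ k ⊟ (nat 2 ⊠ x) ^ k) ≡ half ^ k ⊠ y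
inv-2^k⊟[2x]^k k x y [𝟙⊟x^k]y≡𝟙 = inv-unique (nat 2 ^ k ⊟ (nat 2 ⊠ x) ^ k) (half ^ k ⊠ y) (begin
  (nat 2 ^ k ⊟ (nat 2 ⊠ x) ^ k) ⊠ (half ^ k ⊠ y)
    ≡⟨ cong (λ a → (nat 2 ^ k ⊟ a) ⊠ (half ^ k ⊠ y)) (^-distrib-⊠ (nat 2) x k) ⟩
  (nat 2 ^ k ⊟ nat 2 ^ k ⊠ x ^ k) ⊠ (half ^ k ⊠ y)
    ≡⟨ identity (nat 2 ^ k) (half ^ k) (x ^ k) y ⟩
  (nat 2 ^ k ⊠ half ^ k) ⊠ ((𝟙 ⊟ x ^ k) ⊠ y)
    ≡⟨ cong₂ _⊠_ (2^⊠half^ k) [𝟙⊟x^k]y≡𝟙 ⟩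
  𝟙 ⊠ 𝟙
    ∎)
  where
  identity : ∀ T H X y → (T ⊟ T ⊠ X) ⊠ (H ⊠ y) ≡ (T ⊠ H) ⊠ ((𝟙 ⊟ X) ⊠ y)
  identity = solve-∀ Q5-ring

-- Cyclic indices

[a+b%d]%d≡[a+b]%d : ∀ a b {d} .{{_ : NonZero d}} → (a + b % d) % d ≡ (a + b) % d
[a+b%d]%d≡[a+b]%d a b {d} = begin
  (a + b % d) % d          ≡⟨ %-distribˡ-+ a (b % d) d ⟩
  (a % d + b % d % d) % d  ≡⟨ cong (λ x → (a % d + x) % d) (m%n%n≡m%n b d) ⟩
  (a % d + b % d) % d      ≡⟨ %-distribˡ-+ a b d ⟨
  (a + b) % d              ∎

-- Adding m ∸ a % m undoes adding a, modulo m.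
+-cancelˡ-% : ∀ a {m k l} .{{_ : NonZero m}} → k < m → l < m → (a + k) % m ≡ (a + l) % m → k ≡ l
+-cancelˡ-% a {m} {k} {l} k<m l<m eq =
  trans (sym (undo k<m)) (trans (cong (λ x → (c + x) % m) eq) (undo l<m))
  where
  c = m ∸ a % m
  undo : ∀ {k} → k < m → (c + (a + k) % m) % m ≡ k
  undo {k} k<m = begin
    (c + (a + k) % m) % m                 ≡⟨ [a+b%d]%d≡[a+b]%d c (a + k) ⟩
    (c + (a + k)) % m                     ≡⟨ cong (λ x → (c + (x + k)) % m) (m≡m%n+[m/n]*n a m) ⟩
    (c + (a % m + a / m * m + k)) % m     ≡⟨ cong (_% m) (rearrange c (a % m) (a / m * m) k) ⟩
    (k + (c + a % m) + a / m * m) % m     ≡⟨ cong (λ x → (k + x + a / m * m) % m) (ℕ.m∸n+n≡m (m%n≤n a m)) ⟩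
    (k + m + a / m * m) % m               ≡⟨ cong (_% m) (ℕ.+-assoc k m (a / m * m)) ⟩
    (k + suc (a / m) * m) % m             ≡⟨ [m+kn]%n≡m%n k (suc (a / m)) m ⟩
    k % m                                 ≡⟨ m<n⇒m%n≡m k<m ⟩
    k                                     ∎
    where
    rearrange : ∀ c x y k → c + (x + y + k) ≡ k + (c + x) + y
    rearrange = solve-∀ ℕ-ring

I-sym : ∀ {n} (i j : Fin n) → I n i j ≡ I n j i
I-sym fzero    fzero    = refl
I-sym fzero    (fsuc j) = refl
I-sym (fsuc i) fzero    = refl
I-sym (fsuc i) (fsuc j) = I-sym i j

δ₀ : ℕ → ℚ
δ₀ zero    = 1ℚ
δ₀ (suc _) = 0ℚ

module Cyclic (p : ℕ) where

  m : ℕ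
  m = suc p

  toℕ≤m+ : ∀ (i : Fin m) n → toℕ i ≤ m + n
  toℕ≤m+ i n = ℕ.≤-trans (ℕ.<⇒≤ (Fin.toℕ<n i)) (ℕ.m≤m+n m n)

  circIdx-spec : ∀ (i j : Fin m) → (toℕ i + circIdx m i j) % m ≡ toℕ j
  circIdx-spec i j with toℕ i ≤ᵇ toℕ j | ℕ.≤ᵇ-reflects-≤ (toℕ i) (toℕ j)
  ... | true  | ofʸ i≤j = trans (cong (_% m) (ℕ.m+[n∸m]≡n i≤j)) (m<n⇒m%n≡m (Fin.toℕ<n j))
  ... | false | ofⁿ _   = begin
    (toℕ i + (m + toℕ j ∸ toℕ i)) % m   ≡⟨ cong (_% m) (ℕ.m+[n∸m]≡n (toℕ≤m+ i (toℕ j))) ⟩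
    (m + toℕ j) % m                     ≡⟨ cong (_% m) (ℕ.+-comm m (toℕ j)) ⟩
    (toℕ j + m) % m                     ≡⟨ [m+n]%n≡m%n (toℕ j) m ⟩
    toℕ j % m                           ≡⟨ m<n⇒m%n≡m (Fin.toℕ<n j) ⟩
    toℕ j                               ∎

  circIdx<m : ∀ (i j : Fin m) → circIdx m i j < m
  circIdx<m i j with toℕ i ≤ᵇ toℕ j | ℕ.≤ᵇ-reflects-≤ (toℕ i) (toℕ j)
  ... | true  | ofʸ _   = ℕ.≤-<-trans (ℕ.m∸n≤m (toℕ j) (toℕ i)) (Fin.toℕ<n j)
  ... | false | ofⁿ i≰j = ℕ.+-cancelʳ-< (toℕ i) (m + toℕ j ∸ toℕ i) m
      (subst (_< m + toℕ i) (sym (ℕ.m∸n+n≡m (toℕ≤m+ i (toℕ j)))) (ℕ.+-monoʳ-< m (ℕ.≰⇒> i≰j)))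

  circIdx-unique : ∀ (i j : Fin m) {k} → k < m → (toℕ i + k) % m ≡ toℕ j → circIdx m i j ≡ k
  circIdx-unique i j k<m eq = +-cancelˡ-% (toℕ i) (circIdx<m i j) k<m (trans (circIdx-spec i j) (sym eq))

  next prev : ℕ → ℕ
  next k = suc k % m
  prev k = (p + k) % m

  succᶜ predᶜ : Fin m → Fin m
  succᶜ i = suc (toℕ i) mod m
  predᶜ i = (p + toℕ i) mod m

  toℕ-succᶜ : ∀ i → toℕ (succᶜ i) ≡ next (toℕ i)
  toℕ-succᶜ i = Fin.toℕ-fromℕ< (m%n<n (suc (toℕ i)) m)

  toℕ-predᶜ : ∀ i → toℕ (predᶜ i) ≡ prev (toℕ i)
  toℕ-predᶜ i = Fin.toℕ-fromℕ< (m%n<n (p + toℕ i) m)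

  private
    wraps : ∀ (i j : Fin m) x → x ≡ toℕ i + circIdx m i j + m → x % m ≡ toℕ j
    wraps i j x eq = trans (cong (_% m) eq) (trans ([m+n]%n≡m%n (toℕ i + circIdx m i j) m) (circIdx-spec i j))

  circIdx-predᶜˡ : ∀ (i j : Fin m) → circIdx m (predᶜ i) j ≡ next (circIdx m i j)
  circIdx-predᶜˡ i j = circIdx-unique (predᶜ i) j (m%n<n (suc k) m) (begin
    (toℕ (predᶜ i) + next k) % m        ≡⟨ cong (λ x → (x + next k) % m) (toℕ-predᶜ i) ⟩
    ((p + toℕ i) % m + suc k % m) % m   ≡⟨ %-distribˡ-+ (p + toℕ i) (suc k) m ⟨
    (p + toℕ i + suc k) % m             ≡⟨ wraps i j _ (rearrange p (toℕ i) k) ⟩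
    toℕ j                               ∎)
    where
    k = circIdx m i j
    rearrange : ∀ p a k → p + a + suc k ≡ a + k + suc p
    rearrange = solve-∀ ℕ-ring

  circIdx-succᶜˡ : ∀ (i j : Fin m) → circIdx m (succᶜ i) j ≡ prev (circIdx m i j)
  circIdx-succᶜˡ i j = circIdx-unique (succᶜ i) j (m%n<n (p + k) m) (begin
    (toℕ (succᶜ i) + prev k) % m        ≡⟨ cong (λ x → (x + prev k) % m) (toℕ-succᶜ i) ⟩
    (suc (toℕ i) % m + (p + k) % m) % m ≡⟨ %-distribˡ-+ (suc (toℕ i)) (p + k) m ⟨
    (suc (toℕ i) + (p + k)) % m         ≡⟨ wraps i j _ (rearrange p (toℕ i) k) ⟩
    toℕ j                               ∎)
    where
    k = circIdx m i j
    rearrange : ∀ p a k → suc a + (p + k) ≡ a + k + suc p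
    rearrange = solve-∀ ℕ-ring

  circIdx-succᶜʳ : ∀ (i j : Fin m) → circIdx m i (succᶜ j) ≡ next (circIdx m i j)
  circIdx-succᶜʳ i j = circIdx-unique i (succᶜ j) (m%n<n (suc k) m) (begin
    (toℕ i + suc k % m) % m             ≡⟨ [a+b%d]%d≡[a+b]%d (toℕ i) (suc k) ⟩
    (toℕ i + suc k) % m                 ≡⟨ cong (_% m) (ℕ.+-suc (toℕ i) k) ⟩
    (1 + (toℕ i + k)) % m               ≡⟨ [a+b%d]%d≡[a+b]%d 1 (toℕ i + k) {m} ⟨
    (1 + (toℕ i + k) % m) % m           ≡⟨ cong (λ x → suc x % m) (circIdx-spec i j) ⟩
    suc (toℕ j) % m                     ≡⟨ toℕ-succᶜ j ⟨
    toℕ (succᶜ j)                       ∎)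
    where k = circIdx m i j

  succᶜ-predᶜ : ∀ i → succᶜ (predᶜ i) ≡ i
  succᶜ-predᶜ i = Fin.toℕ-injective (begin
    toℕ (succᶜ (predᶜ i))               ≡⟨ toℕ-succᶜ (predᶜ i) ⟩
    suc (toℕ (predᶜ i)) % m             ≡⟨ cong (λ x → suc x % m) (toℕ-predᶜ i) ⟩
    (1 + (p + toℕ i) % m) % m           ≡⟨ [a+b%d]%d≡[a+b]%d 1 (p + toℕ i) {m} ⟩
    (1 + (p + toℕ i)) % m               ≡⟨ cong (_% m) (ℕ.+-comm m (toℕ i)) ⟩
    (toℕ i + m) % m                     ≡⟨ [m+n]%n≡m%n (toℕ i) m ⟩
    toℕ i % m                           ≡⟨ m<n⇒m%n≡m (Fin.toℕ<n i) ⟩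
    toℕ i                               ∎)

  next-< : ∀ {k} → suc k < m → next k ≡ suc k
  next-< = m<n⇒m%n≡m

  next-m : ∀ {k} → suc k ≡ m → next k ≡ 0
  next-m refl = n%n≡0 m

  prev-zero : prev 0 ≡ p
  prev-zero = trans (cong (_% m) (ℕ.+-identityʳ p)) (m<n⇒m%n≡m (ℕ.n<1+n p))

  prev-suc : ∀ {j} → j < p → prev (suc j) ≡ j
  prev-suc {j} j<p = begin
    (p + suc j) % m   ≡⟨ cong (_% m) (trans (ℕ.+-suc p j) (ℕ.+-comm m j)) ⟩
    (j + m) % m       ≡⟨ [m+n]%n≡m%n j m ⟩
    j % m             ≡⟨ m<n⇒m%n≡m (ℕ.m<n⇒m<1+n j<p) ⟩
    j                 ∎

  I-circIdx : ∀ (i j : Fin m) → I m i j ≡ δ₀ (circIdx m i j)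
  I-circIdx i j with toℕ i ≡ᵇ toℕ j in eq
  ... | true  = cong δ₀ (sym (circIdx-unique i j ℕ.z<s (begin
    (toℕ i + 0) % m   ≡⟨ cong (_% m) (ℕ.+-identityʳ (toℕ i)) ⟩
    toℕ i % m         ≡⟨ m<n⇒m%n≡m (Fin.toℕ<n i) ⟩
    toℕ i             ≡⟨ ℕ.≡ᵇ⇒≡ (toℕ i) (toℕ j) (subst T (sym eq) tt) ⟩
    toℕ j             ∎)))
  ... | false with circIdx m i j | circIdx-spec i j
  ...   | suc _ | _    = refl
  ...   | zero  | spec = ⊥-elim (subst T eq (ℕ.≡⇒≡ᵇ (toℕ i) (toℕ j) (begin
    toℕ i             ≡⟨ m<n⇒m%n≡m (Fin.toℕ<n i) ⟨
    toℕ i % m         ≡⟨ cong (_% m) (ℕ.+-identityʳ (toℕ i)) ⟨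
    (toℕ i + 0) % m   ≡⟨ spec ⟩
    toℕ j             ∎)))

sumFin≡∑ : ∀ {n} (f : Fin n → ℚ) → sumFin f ≡ ∑[ k < n ] f k
sumFin≡∑ {zero}  f = refl
sumFin≡∑ {suc n} f = cong (f fzero ℚ.+_) (sumFin≡∑ (f ∘ fsuc))

sumFin-zero : ∀ {n} {f : Fin n → ℚ} → (∀ k → f k ≡ 0ℚ) → sumFin f ≡ 0ℚ
sumFin-zero {zero}  f≡0 = refl
sumFin-zero {suc n} f≡0 = trans (cong₂ ℚ._+_ (f≡0 fzero) (sumFin-zero (f≡0 ∘ fsuc))) (ℚ.+-identityˡ 0ℚ)

sumFin-δ : ∀ {n} (k : Fin n) (v : Fin n → ℚ) → sumFin (λ l → I n k l ℚ.* v l) ≡ v k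
sumFin-δ fzero    v = trans (cong₂ ℚ._+_ (ℚ.*-identityˡ (v fzero)) (sumFin-zero (λ l → ℚ.*-zeroˡ (v (fsuc l)))))
                            (ℚ.+-identityʳ (v fzero))
sumFin-δ (fsuc k) v = trans (cong₂ ℚ._+_ (ℚ.*-zeroˡ (v fzero)) (sumFin-δ k (v ∘ fsuc)))
                            (ℚ.+-identityˡ (v (fsuc k)))

module _ {n : ℕ} where

  ⊗-congˡ : ∀ {A A′ : Mat n} (B : Mat n) → A ≐ A′ → A ⊗ B ≐ A′ ⊗ B
  ⊗-congˡ {A} {A′} B A≐A′ i j = begin
    sumFin (λ k → A i k ℚ.* B k j)     ≡⟨ sumFin≡∑ (λ k → A i k ℚ.* B k j) ⟩
    ∑[ k < n ] (A i k ℚ.* B k j)       ≡⟨ sum-cong-≗ (λ k → cong (ℚ._* B k j) (A≐A′ i k)) ⟩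
    ∑[ k < n ] (A′ i k ℚ.* B k j)      ≡⟨ sumFin≡∑ (λ k → A′ i k ℚ.* B k j) ⟨
    sumFin (λ k → A′ i k ℚ.* B k j)    ∎

  ⊗-distribʳ-⊕ : ∀ (A B C : Mat n) → (A ⊕ B) ⊗ C ≐ A ⊗ C ⊕ B ⊗ C
  ⊗-distribʳ-⊕ A B C i j = begin
    sumFin (λ k → (A i k ℚ.+ B i k) ℚ.* C k j)
      ≡⟨ sumFin≡∑ (λ k → (A i k ℚ.+ B i k) ℚ.* C k j) ⟩
    ∑[ k < n ] ((A i k ℚ.+ B i k) ℚ.* C k j)
      ≡⟨ sum-cong-≗ (λ k → ℚ.*-distribʳ-+ (C k j) (A i k) (B i k)) ⟩
    ∑[ k < n ] (A i k ℚ.* C k j ℚ.+ B i k ℚ.* C k j)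
      ≡⟨ ∑-distrib-+ (λ k → A i k ℚ.* C k j) (λ k → B i k ℚ.* C k j) ⟩
    ∑[ k < n ] (A i k ℚ.* C k j) ℚ.+ ∑[ k < n ] (B i k ℚ.* C k j)
      ≡⟨ cong₂ ℚ._+_ (sumFin≡∑ (λ k → A i k ℚ.* C k j)) (sumFin≡∑ (λ k → B i k ℚ.* C k j)) ⟨
    (A ⊗ C) i j ℚ.+ (B ⊗ C) i j
      ∎

  ⊗-assoc : ∀ (A B C : Mat n) → (A ⊗ B) ⊗ C ≐ A ⊗ (B ⊗ C)
  ⊗-assoc A B C i j = begin
    sumFin (λ k → (A ⊗ B) i k ℚ.* C k j)
      ≡⟨ sumFin≡∑ (λ k → (A ⊗ B) i k ℚ.* C k j) ⟩
    ∑[ k < n ] ((A ⊗ B) i k ℚ.* C k j)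
      ≡⟨ sum-cong-≗ (λ k → trans (cong (ℚ._* C k j) (sumFin≡∑ (λ l → A i l ℚ.* B l k)))
                                 (*-distribʳ-sum (C k j) (λ l → A i l ℚ.* B l k))) ⟩
    ∑[ k < n ] ∑[ l < n ] (A i l ℚ.* B l k ℚ.* C k j)
      ≡⟨ ∑-comm (λ k l → A i l ℚ.* B l k ℚ.* C k j) ⟩
    ∑[ l < n ] ∑[ k < n ] (A i l ℚ.* B l k ℚ.* C k j)
      ≡⟨ sum-cong-≗ (λ l → sum-cong-≗ (λ k → ℚ.*-assoc (A i l) (B l k) (C k j))) ⟩
    ∑[ l < n ] ∑[ k < n ] (A i l ℚ.* (B l k ℚ.* C k j))
      ≡⟨ sum-cong-≗ (λ l → *-distribˡ-sum (A i l) (λ k → B l k ℚ.* C k j)) ⟨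
    ∑[ l < n ] (A i l ℚ.* ∑[ k < n ] (B l k ℚ.* C k j))
      ≡⟨ sum-cong-≗ (λ l → cong (A i l ℚ.*_) (sumFin≡∑ (λ k → B l k ℚ.* C k j))) ⟨
    ∑[ l < n ] (A i l ℚ.* (B ⊗ C) l j)
      ≡⟨ sumFin≡∑ (λ l → A i l ℚ.* (B ⊗ C) l j) ⟨
    (A ⊗ (B ⊗ C)) i j
      ∎

  rowSelect : (Fin n → Fin n) → Mat n
  rowSelect f i l = I n (f i) l

  rowSelect-⊗ : ∀ f (X : Mat n) i j → (rowSelect f ⊗ X) i j ≡ X (f i) j
  rowSelect-⊗ f X i j = sumFin-δ (f i) (λ l → X l j)

  I⊕rowSelect-⊗ : ∀ {A : Mat n} f → (∀ i l → A i l ≡ I n i l ℚ.+ I n (f i) l) →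
                  ∀ (X : Mat n) i j → (A ⊗ X) i j ≡ X i j ℚ.+ X (f i) j
  I⊕rowSelect-⊗ {A} f A≐ X i j = begin
    (A ⊗ X) i j
      ≡⟨ ⊗-congˡ X A≐ i j ⟩
    ((rowSelect id ⊕ rowSelect f) ⊗ X) i j
      ≡⟨ ⊗-distribʳ-⊕ (rowSelect id) (rowSelect f) X i j ⟩
    (rowSelect id ⊗ X) i j ℚ.+ (rowSelect f ⊗ X) i j
      ≡⟨ cong₂ ℚ._+_ (rowSelect-⊗ id X i j) (rowSelect-⊗ f X i j) ⟩
    X i j ℚ.+ X (f i) j
      ∎

argmax : ∀ {n} (f : Fin (suc n) → ℚ) → ∃[ k ] (∀ i → f i ℚ.≤ f k)
argmax {zero}  f = fzero , λ { fzero → ℚ.≤-refl }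
argmax {suc n} f with argmax (f ∘ fsuc)
... | k , f≤ with ℚ.≤-total (f fzero) (f (fsuc k))
...   | inj₁ f₀≤ = fsuc k , λ { fzero → f₀≤ ; (fsuc i) → f≤ i }
...   | inj₂ f₀≥ = fzero  , λ { fzero → ℚ.≤-refl ; (fsuc i) → ℚ.≤-trans (f≤ i) f₀≥ }

dominant-kernel : ∀ {n} (f g : Fin n → Fin n) (x : Fin n → ℚ) →
                  (∀ i → x (f i) ℚ.+ natℚ 3 ℚ.* x i ℚ.+ x (g i) ≡ 0ℚ) → ∀ i → x i ≡ 0ℚ
dominant-kernel {suc n} f g x Lx≡0 i =
  ℚ.∣p∣≡0⇒p≡0 (x i) (ℚ.≤-antisym (ℚ.≤-trans (≤max i) M≤0) (ℚ.0≤∣p∣ (x i)))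
  where
  k = proj₁ (argmax (λ i → ℚ.∣ x i ∣))
  ≤max = proj₂ (argmax (λ i → ℚ.∣ x i ∣))
  M = ℚ.∣ x k ∣
  3x≡ : natℚ 3 ℚ.* x k ≡ ℚ.- (x (f k) ℚ.+ x (g k))
  3x≡ = isolate (x (f k)) (x k) (x (g k)) (Lx≡0 k)
    where
    middle : ∀ a b c → natℚ 3 ℚ.* b ≡ ℚ.- (a ℚ.+ c) ℚ.+ (a ℚ.+ natℚ 3 ℚ.* b ℚ.+ c)
    middle = solve-∀ ℚ-ring
    isolate : ∀ a b c → a ℚ.+ natℚ 3 ℚ.* b ℚ.+ c ≡ 0ℚ → natℚ 3 ℚ.* b ≡ ℚ.- (a ℚ.+ c)
    isolate a b c eq = trans (middle a b c) (trans (cong (ℚ.- (a ℚ.+ c) ℚ.+_) eq) (ℚ.+-identityʳ (ℚ.- (a ℚ.+ c))))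
  3M≡ : ℚ.∣ x (f k) ℚ.+ x (g k) ∣ ≡ natℚ 3 ℚ.* M
  3M≡ = begin
    ℚ.∣ x (f k) ℚ.+ x (g k) ∣          ≡⟨ ℚ.∣-p∣≡∣p∣ (x (f k) ℚ.+ x (g k)) ⟨
    ℚ.∣ ℚ.- (x (f k) ℚ.+ x (g k)) ∣    ≡⟨ cong ℚ.∣_∣ 3x≡ ⟨
    ℚ.∣ natℚ 3 ℚ.* x k ∣               ≡⟨ ℚ.∣p*q∣≡∣p∣*∣q∣ (natℚ 3) (x k) ⟩
    natℚ 3 ℚ.* M                       ∎
  3M≤2M : natℚ 3 ℚ.* M ℚ.≤ M ℚ.+ M
  3M≤2M = subst (ℚ._≤ M ℚ.+ M) 3M≡
    (ℚ.≤-trans (ℚ.∣p+q∣≤∣p∣+∣q∣ (x (f k)) (x (g k))) (ℚ.+-mono-≤ (≤max (f k)) (≤max (g k))))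
  M≤0 : M ℚ.≤ 0ℚ
  M≤0 = subst₂ ℚ._≤_ (sym (identity M)) (ℚ.+-inverseʳ (M ℚ.+ M)) (ℚ.+-monoˡ-≤ (ℚ.- (M ℚ.+ M)) 3M≤2M)
    where
    identity : ∀ M → M ≡ natℚ 3 ℚ.* M ℚ.- (M ℚ.+ M)
    identity = solve-∀ ℚ-ring

dominant-injective : ∀ {n} (f g : Fin n → Fin n) (x y : Fin n → ℚ) →
  (∀ i → x (f i) ℚ.+ natℚ 3 ℚ.* x i ℚ.+ x (g i) ≡ y (f i) ℚ.+ natℚ 3 ℚ.* y i ℚ.+ y (g i)) →
  ∀ i → x i ≡ y i
dominant-injective f g x y Lx≡Ly i = trans (split (x i) (y i))
  (trans (cong (ℚ._+ y i) (dominant-kernel f g (λ i → x i ℚ.- y i) L[x-y]≡0 i)) (ℚ.+-identityˡ (y i)))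
  where
  split : ∀ a b → a ≡ (a ℚ.- b) ℚ.+ b
  split = solve-∀ ℚ-ring
  linear : ∀ a b c a′ b′ c′ → (a ℚ.- a′) ℚ.+ natℚ 3 ℚ.* (b ℚ.- b′) ℚ.+ (c ℚ.- c′)
                            ≡ (a ℚ.+ natℚ 3 ℚ.* b ℚ.+ c) ℚ.- (a′ ℚ.+ natℚ 3 ℚ.* b′ ℚ.+ c′)
  linear = solve-∀ ℚ-ring
  L[x-y]≡0 : ∀ i → (x (f i) ℚ.- y (f i)) ℚ.+ natℚ 3 ℚ.* (x i ℚ.- y i) ℚ.+ (x (g i) ℚ.- y (g i)) ≡ 0ℚ
  L[x-y]≡0 i = trans (linear (x (f i)) (x i) (x (g i)) (y (f i)) (y i) (y (g i)))
                 (trans (cong (ℚ._- Ly) (Lx≡Ly i)) (ℚ.+-inverseʳ Ly))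
    where Ly = y (f i) ℚ.+ natℚ 3 ℚ.* y i ℚ.+ y (g i)

-- C = circ(1, 0, …, 0, 1) of order m = q + 2 (for m = 1 its two 1s would coincide)

module Circulant (q : ℕ) where

  open Cyclic (suc q) public

  C-coeff : ∀ {k} → k < m →
            (if (k ≡ᵇ 0) ∨ (k ≡ᵇ (m ∸ 1)) then 1ℚ else 0ℚ) ≡ δ₀ k ℚ.+ δ₀ (next k)
  C-coeff {zero}  _     = refl
  C-coeff {suc j} 1+j<m with j ≡ᵇ q in eq
  ... | true  rewrite ℕ.≡ᵇ⇒≡ j q (subst T (sym eq) tt) | next-m {suc q} refl = refl
  ... | false rewrite next-< (ℕ.≤∧≢⇒< 1+j<m λ 2+j≡m →
                                subst T eq (ℕ.≡⇒≡ᵇ j q (ℕ.suc-injective (ℕ.suc-injective 2+j≡m)))) = refl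

  C≐I⊕predᶜ : ∀ (i l : Fin m) → Cmat m i l ≡ I m i l ℚ.+ I m (predᶜ i) l
  C≐I⊕predᶜ i l = begin
    Cmat m i l
      ≡⟨ C-coeff (circIdx<m i l) ⟩
    δ₀ (circIdx m i l) ℚ.+ δ₀ (next (circIdx m i l))
      ≡⟨ cong₂ ℚ._+_ (I-circIdx i l) (trans (I-circIdx (predᶜ i) l) (cong δ₀ (circIdx-predᶜˡ i l))) ⟨
    I m i l ℚ.+ I m (predᶜ i) l
      ∎

  Cᵀ≐I⊕succᶜ : ∀ (i l : Fin m) → transpose (Cmat m) i l ≡ I m i l ℚ.+ I m (succᶜ i) l
  Cᵀ≐I⊕succᶜ i l = begin
    Cmat m l i
      ≡⟨ C-coeff (circIdx<m l i) ⟩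
    δ₀ (circIdx m l i) ℚ.+ δ₀ (next (circIdx m l i))
      ≡⟨ cong₂ ℚ._+_ (I-circIdx l i) (trans (I-circIdx l (succᶜ i)) (cong δ₀ (circIdx-succᶜʳ l i))) ⟨
    I m l i ℚ.+ I m l (succᶜ i)
      ≡⟨ cong₂ ℚ._+_ (I-sym l i) (I-sym l (succᶜ i)) ⟩
    I m i l ℚ.+ I m (succᶜ i) l
      ∎

  A : Mat m
  A = (Cmat m ⊗ transpose (Cmat m)) ⊕ I m

  Cᵀ⊗-row : ∀ (X : Mat m) i j → (transpose (Cmat m) ⊗ X) i j ≡ X i j ℚ.+ X (succᶜ i) j
  Cᵀ⊗-row = I⊕rowSelect-⊗ succᶜ Cᵀ≐I⊕succᶜ

  A⊗-row : ∀ (X : Mat m) i j → (A ⊗ X) i j ≡ X (predᶜ i) j ℚ.+ natℚ 3 ℚ.* X i j ℚ.+ X (succᶜ i) j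
  A⊗-row X i j = begin
    (A ⊗ X) i j
      ≡⟨ ⊗-distribʳ-⊕ (C ⊗ Cᵀ) (I m) X i j ⟩
    ((C ⊗ Cᵀ) ⊗ X) i j ℚ.+ (I m ⊗ X) i j
      ≡⟨ cong₂ ℚ._+_ (⊗-assoc C Cᵀ X i j) (rowSelect-⊗ id X i j) ⟩
    (C ⊗ (Cᵀ ⊗ X)) i j ℚ.+ X i j
      ≡⟨ cong (ℚ._+ X i j) (I⊕rowSelect-⊗ predᶜ C≐I⊕predᶜ (Cᵀ ⊗ X) i j) ⟩
    ((Cᵀ ⊗ X) i j ℚ.+ (Cᵀ ⊗ X) (predᶜ i) j) ℚ.+ X i j
      ≡⟨ cong₂ (λ a b → (a ℚ.+ b) ℚ.+ X i j) (Cᵀ⊗-row X i j) (Cᵀ⊗-row X (predᶜ i) j) ⟩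
    ((X i j ℚ.+ X (succᶜ i) j) ℚ.+ (X (predᶜ i) j ℚ.+ X (succᶜ (predᶜ i)) j)) ℚ.+ X i j
      ≡⟨ cong (λ k → ((X i j ℚ.+ X (succᶜ i) j) ℚ.+ (X (predᶜ i) j ℚ.+ X k j)) ℚ.+ X i j)
              (succᶜ-predᶜ i) ⟩
    ((X i j ℚ.+ X (succᶜ i) j) ℚ.+ (X (predᶜ i) j ℚ.+ X i j)) ℚ.+ X i j
      ≡⟨ collect (X (predᶜ i) j) (X i j) (X (succᶜ i) j) ⟩
    X (predᶜ i) j ℚ.+ natℚ 3 ℚ.* X i j ℚ.+ X (succᶜ i) j
      ∎
    where
    C = Cmat m
    Cᵀ = transpose (Cmat m)
    collect : ∀ a b c → ((b ℚ.+ c) ℚ.+ (a ℚ.+ b)) ℚ.+ b ≡ a ℚ.+ natℚ 3 ℚ.* b ℚ.+ c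
    collect = solve-∀ ℚ-ring

-- The explicit solution

module ClosedForm (q : ℕ) where

  p : ℕ
  p = suc q

  open Cyclic p

  ρ σ : Q5
  ρ = (𝟙 ⊟ s ^ m) ⊠ embed (invℚ (natℚ 2 ℚ.- −1^ m ℚ.* natℚ (lucas m)))
  σ = (𝟙 ⊟ r ^ m) ⊠ embed (invℚ (natℚ 2 ℚ.- −1^ m ℚ.* natℚ (lucas m)))

  ρ-inverse : (𝟙 ⊟ r ^ m) ⊠ ρ ≡ 𝟙
  ρ-inverse = ⊠-inverse-from-norm (𝟙 ⊟ r ^ m) (𝟙 ⊟ s ^ m) ([𝟙⊟r^k][𝟙⊟s^k] m) (2-±lucas≢0 p)

  σ-inverse : (𝟙 ⊟ s ^ m) ⊠ σ ≡ 𝟙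
  σ-inverse = ⊠-inverse-from-norm (𝟙 ⊟ s ^ m) (𝟙 ⊟ r ^ m)
    (trans (⊠-comm (𝟙 ⊟ s ^ m) (𝟙 ⊟ r ^ m)) ([𝟙⊟r^k][𝟙⊟s^k] m)) (2-±lucas≢0 p)

  G : ℕ → Q5
  G k = (r ^ k ⊠ ρ ⊟ s ^ k ⊠ σ) ⊘ √5

  G-rec : ∀ k → G k ⊞ nat 3 ⊠ G (suc k) ⊞ G (suc (suc k)) ≡ 𝟘
  G-rec k = begin
    G k ⊞ nat 3 ⊠ G (suc k) ⊞ G (suc (suc k))
      ≡⟨ cong₂ (λ a b → G k ⊞ nat 3 ⊠ G (suc k) ⊞ (a ⊠ ρ ⊟ b ⊠ σ) ⊘ √5)
               (^-rec r r-root k) (^-rec s s-root k) ⟩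
    G k ⊞ nat 3 ⊠ G (suc k)
      ⊞ ((neg (nat 3 ⊠ r ^ suc k) ⊟ r ^ k) ⊠ ρ ⊟ (neg (nat 3 ⊠ s ^ suc k) ⊟ s ^ k) ⊠ σ) ⊘ √5
      ≡⟨ cancel (r ^ k) (r ^ suc k) (s ^ k) (s ^ suc k) ρ σ ⟩
    𝟘 ∎
    where
    cancel : ∀ a a₁ b b₁ ρ σ →
      (a ⊠ ρ ⊟ b ⊠ σ) ⊠ inv √5 ⊞ nat 3 ⊠ ((a₁ ⊠ ρ ⊟ b₁ ⊠ σ) ⊠ inv √5)
        ⊞ ((neg (nat 3 ⊠ a₁) ⊟ a) ⊠ ρ ⊟ (neg (nat 3 ⊠ b₁) ⊟ b) ⊠ σ) ⊠ inv √5 ≡ 𝟘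
    cancel = solve-∀ Q5-ring

  G-shift : ∀ k → G k ⊟ G (k + m) ≡ (r ^ k ⊟ s ^ k) ⊘ √5
  G-shift k = begin
    G k ⊟ G (k + m)
      ≡⟨ cong₂ (λ a b → G k ⊟ (a ⊠ ρ ⊟ b ⊠ σ) ⊘ √5) (^-homo-⊠ r k m) (^-homo-⊠ s k m) ⟩
    G k ⊟ ((r ^ k ⊠ r ^ m) ⊠ ρ ⊟ (s ^ k ⊠ s ^ m) ⊠ σ) ⊘ √5
      ≡⟨ factor (r ^ k) (r ^ m) (s ^ k) (s ^ m) ρ σ ⟩
    (r ^ k ⊠ ((𝟙 ⊟ r ^ m) ⊠ ρ) ⊟ s ^ k ⊠ ((𝟙 ⊟ s ^ m) ⊠ σ)) ⊘ √5
      ≡⟨ cong₂ (λ x y → (r ^ k ⊠ x ⊟ s ^ k ⊠ y) ⊘ √5) ρ-inverse σ-inverse ⟩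
    (r ^ k ⊠ 𝟙 ⊟ s ^ k ⊠ 𝟙) ⊘ √5
      ≡⟨ cong₂ (λ x y → (x ⊟ y) ⊘ √5) (⊠-identityʳ (r ^ k)) (⊠-identityʳ (s ^ k)) ⟩
    (r ^ k ⊟ s ^ k) ⊘ √5 ∎
    where
    factor : ∀ a aₘ b bₘ ρ σ →
      (a ⊠ ρ ⊟ b ⊠ σ) ⊠ inv √5 ⊟ ((a ⊠ aₘ) ⊠ ρ ⊟ (b ⊠ bₘ) ⊠ σ) ⊠ inv √5
        ≡ (a ⊠ ((𝟙 ⊟ aₘ) ⊠ ρ) ⊟ b ⊠ ((𝟙 ⊟ bₘ) ⊠ σ)) ⊠ inv √5
    factor = solve-∀ Q5-ring

  G[m]≡G[0] : G m ≡ G 0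
  G[m]≡G[0] = sym (x∙y⁻¹≈ε⇒x≈y (G 0) (G m) (G-shift 0))

  G[1]⊟G[1+m]≡𝟙 : G 1 ⊟ G (suc m) ≡ 𝟙
  G[1]⊟G[1+m]≡𝟙 = G-shift 1

  G-next : ∀ {k} → k < m → G (next k) ≡ G (suc k)
  G-next k<m =
    [ (λ 1+k<m → cong G (next-< 1+k<m))
    , (λ 1+k≡m → trans (cong G (next-m 1+k≡m)) (trans (sym G[m]≡G[0]) (cong G (sym 1+k≡m))))
    ]′ (ℕ.m≤n⇒m<n∨m≡n k<m)

  G-cyclic : ∀ {k} → k < m → G (next k) ⊞ nat 3 ⊠ G k ⊞ G (prev k) ≡ embed (δ₀ k)
  G-cyclic {zero} 0<m = begin
    G (next 0) ⊞ nat 3 ⊠ G 0 ⊞ G (prev 0)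
      ≡⟨ cong₂ (λ a c → a ⊞ nat 3 ⊠ G 0 ⊞ c) (G-next 0<m) (cong G prev-zero) ⟩
    G 1 ⊞ nat 3 ⊠ G 0 ⊞ G p
      ≡⟨ cong (λ b → G 1 ⊞ nat 3 ⊠ b ⊞ G p) G[m]≡G[0] ⟨
    G 1 ⊞ nat 3 ⊠ G m ⊞ G p
      ≡⟨ regroup (G 1) (G m) (G p) (G (suc m)) ⟩
    (G 1 ⊟ G (suc m)) ⊞ (G p ⊞ nat 3 ⊠ G m ⊞ G (suc m))
      ≡⟨ cong₂ _⊞_ G[1]⊟G[1+m]≡𝟙 (G-rec p) ⟩
    𝟙 ⊞ 𝟘 ∎
    where
    regroup : ∀ g₁ gₘ gₚ gₘ₊₁ →
      g₁ ⊞ nat 3 ⊠ gₘ ⊞ gₚ ≡ (g₁ ⊟ gₘ₊₁) ⊞ (gₚ ⊞ nat 3 ⊠ gₘ ⊞ gₘ₊₁)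
    regroup = solve-∀ Q5-ring
  G-cyclic {suc j} 1+j<m = begin
    G (next (suc j)) ⊞ nat 3 ⊠ G (suc j) ⊞ G (prev (suc j))
      ≡⟨ cong₂ (λ a c → a ⊞ nat 3 ⊠ G (suc j) ⊞ c) (G-next 1+j<m) (cong G (prev-suc (ℕ.≤-pred 1+j<m))) ⟩
    G (suc (suc j)) ⊞ nat 3 ⊠ G (suc j) ⊞ G j
      ≡⟨ reverse (G j) (G (suc j)) (G (suc (suc j))) ⟩
    G j ⊞ nat 3 ⊠ G (suc j) ⊞ G (suc (suc j))
      ≡⟨ G-rec j ⟩
    𝟘 ∎
    where
    reverse : ∀ a b c → c ⊞ nat 3 ⊠ b ⊞ a ≡ a ⊞ nat 3 ⊠ b ⊞ c
    reverse = solve-∀ Q5-ring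

  -- The constant −2/5 produces the −2J part of the right-hand side, since 1 + 3 + 1 = 5.
  z : ℕ → Q5
  z k = nat 2 ⊠ nat m ⊠ G k ⊟ embed (+ 2 ℚ./ 5)

  z-cyclic : ∀ {k} → k < m →
             z (next k) ⊞ nat 3 ⊠ z k ⊞ z (prev k) ≡ embed (natℚ 2 ℚ.* (natℚ m ℚ.* δ₀ k ℚ.- 1ℚ))
  z-cyclic {k} k<m = begin
    z (next k) ⊞ nat 3 ⊠ z k ⊞ z (prev k)
      ≡⟨ collect (G (next k)) (G k) (G (prev k)) (nat m) ⟩
    nat 2 ⊠ nat m ⊠ (G (next k) ⊞ nat 3 ⊠ G k ⊞ G (prev k)) ⊟ nat 2
      ≡⟨ cong (λ x → nat 2 ⊠ nat m ⊠ x ⊟ nat 2) (G-cyclic k<m) ⟩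
    nat 2 ⊠ nat m ⊠ embed (δ₀ k) ⊟ nat 2
      ≡⟨ distribute (nat m) (embed (δ₀ k)) ⟩
    nat 2 ⊠ (nat m ⊠ embed (δ₀ k) ⊟ 𝟙)
      ≡⟨ cong (λ x → nat 2 ⊠ (x ⊟ 𝟙)) (embed-⊠ (natℚ m) (δ₀ k)) ⟩
    nat 2 ⊠ embed (natℚ m ℚ.* δ₀ k ℚ.- 1ℚ)
      ≡⟨ embed-⊠ (natℚ 2) (natℚ m ℚ.* δ₀ k ℚ.- 1ℚ) ⟩
    embed (natℚ 2 ℚ.* (natℚ m ℚ.* δ₀ k ℚ.- 1ℚ)) ∎
    where
    collect : ∀ g₁ g₀ g₂ M →
      (nat 2 ⊠ M ⊠ g₁ ⊟ embed (+ 2 ℚ./ 5)) ⊞ nat 3 ⊠ (nat 2 ⊠ M ⊠ g₀ ⊟ embed (+ 2 ℚ./ 5))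
        ⊞ (nat 2 ⊠ M ⊠ g₂ ⊟ embed (+ 2 ℚ./ 5))
      ≡ nat 2 ⊠ M ⊠ (g₁ ⊞ nat 3 ⊠ g₀ ⊞ g₂) ⊟ nat 2
    collect = solve-∀ Q5-ring
    distribute : ∀ M D → nat 2 ⊠ M ⊠ D ⊟ nat 2 ≡ nat 2 ⊠ (M ⊠ D ⊟ 𝟙)
    distribute = solve-∀ Q5-ring

  inv-2^m⊟α^m : inv (nat 2 ^ m ⊟ α ^ m) ≡ half ^ m ⊠ ρ
  inv-2^m⊟α^m = inv-2^k⊟[2x]^k m r ρ ρ-inverse

  inv-2^m⊟β^m : inv (nat 2 ^ m ⊟ β ^ m) ≡ half ^ m ⊠ σ
  inv-2^m⊟β^m = inv-2^k⊟[2x]^k m s σ σ-inverse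

  d-zero : 𝟙 ⊞ z 0 ⊞ z p ≡ d (suc m) 0
  d-zero = begin
    𝟙 ⊞ z 0 ⊞ z p
      ≡⟨ ours (nat m) (r ^ p) (s ^ p) ρ σ ⟩
    core 𝟙
      ≡⟨ cong core (2^⊠half^ p) ⟨
    core (nat 2 ^ p ⊠ half ^ p)
      ≡⟨ paper (nat m) (r ^ p) (s ^ p) ρ σ (nat 2 ^ p) (half ^ p) ⟩
    d₀ (nat 2 ^ p ⊠ r ^ p) (nat 2 ^ p ⊠ s ^ p) (half ^ m ⊠ ρ) (half ^ m ⊠ σ)
      ≡⟨ cong₂ (λ a b → d₀ a b (half ^ m ⊠ ρ) (half ^ m ⊠ σ)) (α^ p) (β^ p) ⟨
    d₀ (α ^ p) (β ^ p) (half ^ m ⊠ ρ) (half ^ m ⊠ σ)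
      ≡⟨ cong₂ (d₀ (α ^ p) (β ^ p)) inv-2^m⊟α^m inv-2^m⊟β^m ⟨
    d (suc m) 0 ∎
    where
    d₀ : Q5 → Q5 → Q5 → Q5 → Q5
    d₀ A B Iα Iβ =
      (nat 1 ⊘ nat 5) ⊞ ((nat 4 ⊠ nat m) ⊘ √5) ⊠ ((nat 2 ^ p ⊞ A) ⊠ Iα ⊟ (nat 2 ^ p ⊞ B) ⊠ Iβ)
    core : Q5 → Q5
    core X =
      (nat 1 ⊘ nat 5) ⊞ (nat 2 ⊠ nat m ⊠ inv √5) ⊠ ((𝟙 ⊞ r ^ p) ⊠ ρ ⊟ (𝟙 ⊞ s ^ p) ⊠ σ) ⊠ X
    ours : ∀ M R S ρ σ →
      𝟙 ⊞ (nat 2 ⊠ M ⊠ ((𝟙 ⊠ ρ ⊟ 𝟙 ⊠ σ) ⊠ inv √5) ⊟ embed (+ 2 ℚ./ 5))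
        ⊞ (nat 2 ⊠ M ⊠ ((R ⊠ ρ ⊟ S ⊠ σ) ⊠ inv √5) ⊟ embed (+ 2 ℚ./ 5))
      ≡ nat 1 ⊠ inv (nat 5) ⊞ (nat 2 ⊠ M ⊠ inv √5) ⊠ ((𝟙 ⊞ R) ⊠ ρ ⊟ (𝟙 ⊞ S) ⊠ σ) ⊠ 𝟙
    ours = solve-∀ Q5-ring
    paper : ∀ M R S ρ σ T H →
      nat 1 ⊠ inv (nat 5) ⊞ (nat 2 ⊠ M ⊠ inv √5) ⊠ ((𝟙 ⊞ R) ⊠ ρ ⊟ (𝟙 ⊞ S) ⊠ σ) ⊠ (T ⊠ H)
      ≡ nat 1 ⊠ inv (nat 5) ⊞ ((nat 4 ⊠ M) ⊠ inv √5)
          ⊠ ((T ⊞ T ⊠ R) ⊠ ((half ⊠ H) ⊠ ρ) ⊟ (T ⊞ T ⊠ S) ⊠ ((half ⊠ H) ⊠ σ))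
    paper = solve-∀ Q5-ring

  2^[m+1∸i]⊠2^i⊠half^p : ∀ {i} → i < p → nat 2 ^ ((m + 1) ∸ i) ⊠ nat 2 ^ i ⊠ half ^ p ≡ nat 4
  2^[m+1∸i]⊠2^i⊠half^p {i} i<p = begin
    nat 2 ^ ((m + 1) ∸ i) ⊠ nat 2 ^ i ⊠ half ^ p
      ≡⟨ cong (_⊠ half ^ p) (^-homo-⊠ (nat 2) ((m + 1) ∸ i) i) ⟨
    nat 2 ^ ((m + 1) ∸ i + i) ⊠ half ^ p
      ≡⟨ cong (λ k → nat 2 ^ k ⊠ half ^ p) exponent ⟩
    nat 2 ⊠ (nat 2 ⊠ nat 2 ^ p) ⊠ half ^ p
      ≡⟨ regroup (nat 2 ^ p) (half ^ p) ⟩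
    nat 4 ⊠ (nat 2 ^ p ⊠ half ^ p)
      ≡⟨ cong (nat 4 ⊠_) (2^⊠half^ p) ⟩
    nat 4 ⊠ 𝟙
      ∎
    where
    i≤m+1 : i ≤ m + 1
    i≤m+1 = ℕ.≤-trans (ℕ.<⇒≤ i<p) (ℕ.≤-trans (ℕ.n≤1+n p) (ℕ.m≤m+n m 1))
    exponent : (m + 1) ∸ i + i ≡ suc (suc p)
    exponent = trans (ℕ.m∸n+n≡m i≤m+1) (ℕ.+-comm m 1)
    regroup : ∀ T H → nat 2 ⊠ (nat 2 ⊠ T) ⊠ H ≡ nat 4 ⊠ (T ⊠ H)
    regroup = solve-∀ Q5-ring

  d-suc : ∀ {i} → i < p → 𝟙 ⊞ z (suc i) ⊞ z i ≡ d (suc m) (suc i)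
  d-suc {i} i<p = begin
    𝟙 ⊞ z (suc i) ⊞ z i
      ≡⟨ ours (nat m) (r ^ i) (s ^ i) ρ σ ⟩
    core (nat 4)
      ≡⟨ cong core (2^[m+1∸i]⊠2^i⊠half^p i<p) ⟨
    core (E ⊠ nat 2 ^ i ⊠ half ^ p)
      ≡⟨ paper (nat m) (r ^ i) (s ^ i) ρ σ E (nat 2 ^ i) (half ^ p) ⟩
    dₛ (nat 2 ^ i ⊠ r ^ i) (nat 2 ^ i ⊠ s ^ i) (half ^ m ⊠ ρ) (half ^ m ⊠ σ)
      ≡⟨ cong₂ (λ a b → dₛ a b (half ^ m ⊠ ρ) (half ^ m ⊠ σ)) (α^ i) (β^ i) ⟨
    dₛ (α ^ i) (β ^ i) (half ^ m ⊠ ρ) (half ^ m ⊠ σ)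
      ≡⟨ cong₂ (dₛ (α ^ i) (β ^ i)) inv-2^m⊟α^m inv-2^m⊟β^m ⟨
    d (suc m) (suc i) ∎
    where
    E = nat 2 ^ ((m + 1) ∸ i)
    dₛ : Q5 → Q5 → Q5 → Q5 → Q5
    dₛ A B Iα Iβ =
      (nat 1 ⊘ nat 5) ⊞ ((E ⊠ nat m) ⊘ (nat 5 ⊞ √5)) ⊠ ((nat 2 ⊠ A) ⊠ Iα ⊟ (β ⊠ B) ⊠ Iβ)
    core : Q5 → Q5
    core X = (nat 1 ⊘ nat 5) ⊞ (nat m ⊠ inv (nat 5 ⊞ √5)) ⊠ (r ^ i ⊠ ρ ⊟ (s ⊠ s ^ i) ⊠ σ) ⊠ X
    ours : ∀ M R S ρ σ →
      𝟙 ⊞ (nat 2 ⊠ M ⊠ (((r ⊠ R) ⊠ ρ ⊟ (s ⊠ S) ⊠ σ) ⊠ inv √5) ⊟ embed (+ 2 ℚ./ 5))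
        ⊞ (nat 2 ⊠ M ⊠ ((R ⊠ ρ ⊟ S ⊠ σ) ⊠ inv √5) ⊟ embed (+ 2 ℚ./ 5))
      ≡ nat 1 ⊠ inv (nat 5) ⊞ (M ⊠ inv (nat 5 ⊞ √5)) ⊠ (R ⊠ ρ ⊟ (s ⊠ S) ⊠ σ) ⊠ nat 4
    ours = solve-∀ Q5-ring
    paper : ∀ M R S ρ σ E T H →
      nat 1 ⊠ inv (nat 5) ⊞ (M ⊠ inv (nat 5 ⊞ √5)) ⊠ (R ⊠ ρ ⊟ (s ⊠ S) ⊠ σ) ⊠ (E ⊠ T ⊠ H)
      ≡ nat 1 ⊠ inv (nat 5) ⊞ ((E ⊠ M) ⊠ inv (nat 5 ⊞ √5))
          ⊠ ((nat 2 ⊠ (T ⊠ R)) ⊠ ((half ⊠ H) ⊠ ρ) ⊟ (β ⊠ (T ⊠ S)) ⊠ ((half ⊠ H) ⊠ σ))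
    paper = solve-∀ Q5-ring

  d-closed : ∀ {k} → k < m → 𝟙 ⊞ z k ⊞ z (prev k) ≡ d (suc m) k
  d-closed {zero}  _     = trans (cong (λ k → 𝟙 ⊞ z 0 ⊞ z k) prev-zero) d-zero
  d-closed {suc i} 1+i<m = trans (cong (λ k → 𝟙 ⊞ z (suc i) ⊞ z k) (prev-suc i<p)) (d-suc i<p)
    where i<p = ℕ.≤-pred 1+i<m

module Solution (q : ℕ) where

  open Circulant q
  open ClosedForm q using (z; z-cyclic; d-closed)

  B : Mat m
  B = scale (natℚ 2) (scale (natℚ m) (I m) ⊖ J m)

  Z : Fin m → Fin m → Q5
  Z i j = z (circIdx m i j)

  Z-solves : ∀ i j → Z (predᶜ i) j ⊞ nat 3 ⊠ Z i j ⊞ Z (succᶜ i) j ≡ embed (B i j)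
  Z-solves i j = begin
    z (circIdx m (predᶜ i) j) ⊞ nat 3 ⊠ z k ⊞ z (circIdx m (succᶜ i) j)
      ≡⟨ cong₂ (λ a b → z a ⊞ nat 3 ⊠ z k ⊞ z b) (circIdx-predᶜˡ i j) (circIdx-succᶜˡ i j) ⟩
    z (next k) ⊞ nat 3 ⊠ z k ⊞ z (prev k)
      ≡⟨ z-cyclic (circIdx<m i j) ⟩
    embed (natℚ 2 ℚ.* (natℚ m ℚ.* δ₀ k ℚ.- 1ℚ))
      ≡⟨ cong (λ x → embed (natℚ 2 ℚ.* (natℚ m ℚ.* x ℚ.- 1ℚ))) (I-circIdx i j) ⟨
    embed (B i j) ∎
    where k = circIdx m i j

  Z-real : ∀ i j → im (Z i j) ≡ 0ℚ
  Z-real i j = dominant-kernel predᶜ succᶜ (λ i → im (Z i j))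
    (λ i → trans (sym (im-3term (Z (predᶜ i) j) (Z i j) (Z (succᶜ i) j))) (cong im (Z-solves i j))) i

  X₀ : Mat m
  X₀ i j = re (Z i j)

  X₀-solves : A ⊗ X₀ ≐ B
  X₀-solves i j = trans (A⊗-row X₀ i j)
    (trans (sym (re-3term (Z (predᶜ i) j) (Z i j) (Z (succᶜ i) j))) (cong re (Z-solves i j)))

  solution-unique : ∀ X → A ⊗ X ≐ B → X ≐ X₀
  solution-unique X AX≐B i j = dominant-injective predᶜ succᶜ (λ i → X i j) (λ i → X₀ i j)
    (λ i → trans (sym (A⊗-row X i j)) (trans (AX≐B i j) (trans (sym (X₀-solves i j)) (A⊗-row X₀ i j)))) i

  Y-circulant : ∀ X → A ⊗ X ≐ B → ∀ i j →
                embed ((J m ⊕ (transpose (Cmat m) ⊗ X)) i j) ≡ circ m (d (suc m)) i j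
  Y-circulant X AX≐B i j = begin
    embed (1ℚ ℚ.+ (transpose (Cmat m) ⊗ X) i j)
      ≡⟨ cong (λ y → embed (1ℚ ℚ.+ y)) (Cᵀ⊗-row X i j) ⟩
    embed (1ℚ ℚ.+ (X i j ℚ.+ X (succᶜ i) j))
      ≡⟨ cong₂ (λ a b → embed (1ℚ ℚ.+ (a ℚ.+ b)))
               (solution-unique X AX≐B i j) (solution-unique X AX≐B (succᶜ i) j) ⟩
    𝟙 ⊞ (embed (re (Z i j)) ⊞ embed (re (Z (succᶜ i) j)))
      ≡⟨ cong₂ (λ a b → 𝟙 ⊞ (a ⊞ b))
               (embed-re (Z i j) (Z-real i j)) (embed-re (Z (succᶜ i) j) (Z-real (succᶜ i) j)) ⟩
    𝟙 ⊞ (Z i j ⊞ Z (succᶜ i) j)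
      ≡⟨ ⊞-assoc 𝟙 (Z i j) (Z (succᶜ i) j) ⟨
    𝟙 ⊞ z k ⊞ z (circIdx m (succᶜ i) j)
      ≡⟨ cong (λ l → 𝟙 ⊞ z k ⊞ z l) (circIdx-succᶜˡ i j) ⟩
    𝟙 ⊞ z k ⊞ z (prev k)
      ≡⟨ d-closed (circIdx<m i j) ⟩
    d (suc m) k ∎
    where k = circIdx m i j

mainTheorem4 : (n : ℕ) → 4 ≤ n →
    -- X = 2 (C Cᵀ + I)⁻¹ [(n-1) I - J]: such an X exists (CCᵀ+I invertible) ...
    Σ (Mat (n ∸ 1)) (λ X →
        ((Cmat (n ∸ 1) ⊗ transpose (Cmat (n ∸ 1))) ⊕ I (n ∸ 1)) ⊗ X
          ≐ scale (natℚ 2) (scale (natℚ (n ∸ 1)) (I (n ∸ 1)) ⊖ J (n ∸ 1)))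
    × -- ... and (it being unique) Y = J + Cᵀ X equals circ(d_0, …, d_{n-2})
    ((X : Mat (n ∸ 1)) →
      ((Cmat (n ∸ 1) ⊗ transpose (Cmat (n ∸ 1))) ⊕ I (n ∸ 1)) ⊗ X
        ≐ scale (natℚ 2) (scale (natℚ (n ∸ 1)) (I (n ∸ 1)) ⊖ J (n ∸ 1)) →
      (i j : Fin (n ∸ 1)) →
        embed ((J (n ∸ 1) ⊕ (transpose (Cmat (n ∸ 1)) ⊗ X)) i j)
          ≡ circ (n ∸ 1) (d n) i j)
mainTheorem4 (suc (suc (suc (suc q)))) (s≤s (s≤s (s≤s (s≤s _)))) = (X₀ , X₀-solves) , Y-circulant
  where open Solution (suc q)
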